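{- Let $X$ be a finite non-empty set and $R$ a monotone transit function on $X$ satisfying (uc): for all $x,y,u,v\in X$, if $R(x,y)\cap R(u,v)\neq\emptyset$ then there are $p,q\in R(x,y)\cup R(u,v)$ with $R(x,y)\cup R(u,v)=R(p,q)$. Then $R$ satisfies (x): for all $x,y,z\in X$, $R(x,y)\subseteq R(x,z)\cup R(z,y)$.
   Context: A transit function on a finite non-empty set $X$ is a map $R:X\times X\to 2^X$ such that for all $u,v\in X$: $u\in R(u,v)$, $R(u,v)=R(v,u)$, and $R(u,u)=\{u\}$. $R$ is monotone if for all $u,v,p,q\in X$, $p,q\in R(u,v)$ implies $R(p,q)\subseteq R(u,v)$. -}

module Defs where

open import Data.Nat using (ℕ)
open import Data.Fin using (Fin)
open import Data.Fin.Subset using (Subset; _∈_; _⊆_; _∪_; _∩_; ⁅_⁆; Nonempty)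
open import Data.Product using (_×_; ∃₂)
open import Relation.Binary.PropositionalEquality using (_≡_)

-- A finite set X is modelled as Fin n; subsets of X as Subset n.
-- A map R : X × X → 2^X.
Map : ℕ → Set
Map n = Fin n → Fin n → Subset n

IsTransit : ∀ {n} → Map n → Set
IsTransit {n} R =
  (∀ (u v : Fin n) → u ∈ R u v) ×
  (∀ (u v : Fin n) → R u v ≡ R v u) ×
  (∀ (u : Fin n) → R u u ≡ ⁅ u ⁆)

Monotone : ∀ {n} → Map n → Set
Monotone {n} R = ∀ (u v p q : Fin n) → p ∈ R u v → q ∈ R u v → R p q ⊆ R u v

UC : ∀ {n} → Map n → Set
UC {n} R = ∀ (x y u v : Fin n) → Nonempty (R x y ∩ R u v) →
  ∃₂ λ p q → p ∈ (R x y ∪ R u v) × q ∈ (R x y ∪ R u v) × (R x y ∪ R u v ≡ R p q)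

AxiomX : ∀ {n} → Map n → Set
AxiomX {n} R = ∀ (x y z : Fin n) → R x y ⊆ (R x z ∪ R z y)

{-# OPTIONS --safe #-}
module Submission where

open import Defs
open import Data.Nat using (ℕ; suc)
open import Data.Fin.Subset using (_∈_; _⊆_; _∪_)
open import Data.Fin.Subset.Properties using (p⊆p∪q; q⊆p∪q; x∈p∩q⁺)
open import Data.Product using (_,_; ∃₂; proj₁)
open import Relation.Binary.PropositionalEquality using (_≡_; refl; subst)

module _ {n} {R : Map n} where

  ∈-left : IsTransit R → ∀ u v → u ∈ R u v
  ∈-left = proj₁

  ∈-right : IsTransit R → ∀ u v → v ∈ R u v
  ∈-right (u∈R , R-sym , _) u v = subst (v ∈_) (R-sym v u) (u∈R v u)

  Monotone⇒⊆-interval : Monotone R → ∀ {S p q x y} →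
                        S ≡ R p q → x ∈ S → y ∈ S → R x y ⊆ S
  Monotone⇒⊆-interval mono {p = p} {q} {x} {y} refl x∈S y∈S = mono p q x y x∈S y∈S

  -- The intervals R x z and R z y always meet in z.
  UC⇒adjacent-∪-interval : IsTransit R → UC R →
                           ∀ x y z → ∃₂ λ p q → R x z ∪ R z y ≡ R p q
  UC⇒adjacent-∪-interval transit uc x y z
    with uc x z z y (z , x∈p∩q⁺ (∈-right transit x z , ∈-left transit z y))
  ... | p , q , _ , _ , ∪≡R = p , q , ∪≡R

corollary1 : (m : ℕ) (R : Map (suc m)) → IsTransit R → Monotone R → UC R → AxiomX R
corollary1 m R transit mono uc x y z
  with UC⇒adjacent-∪-interval transit uc x y z
... | p , q , ∪≡R =
  Monotone⇒⊆-interval mono ∪≡R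
    (p⊆p∪q (R z y) (∈-left transit x z))
    (q⊆p∪q (R x z) (R z y) (∈-right transit z y))
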